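{- A plane belonging to the $K$-orbit $\Sigma_{11}$ has point-orbit distribution $[1,q,0,q^2]$.
   Context: $q$ is odd. Points of $\mathrm{PG}(5,q)$ are represented by symmetric $3\times3$ matrices over $\mathbb{F}_q$ (up to scalars), with rank equal to the matrix rank; rank-1 points form the quadric Veronesean $\mathcal{V}(\mathbb{F}_q)$. $K=\mathrm{PGL}(3,q)$ acts via $M\mapsto AMA^T$. Each rank-2 point $z$ lies in the plane of a unique conic $\mathcal{C}_z\subset\mathcal{V}(\mathbb{F}_q)$; $z$ is exterior ($\mathcal{P}_{2,e}$) if it lies on a tangent to $\mathcal{C}_z$ and interior ($\mathcal{P}_{2,i}$) otherwise. The point-orbit distribution is $[n_1,n_2,n_3,n_4]$ = numbers of points of rank 1, of $\mathcal{P}_{2,e}$, of $\mathcal{P}_{2,i}$, of rank 3. $\Sigma_{11}$ is the $K$-orbit of the plane $\{\begin{pmatrix}0&\beta&\gamma\\ \beta&\alpha&\alpha\\ \gamma&\alpha&\alpha+\gamma\end{pmatrix}\}$, $(\alpha,\beta,\gamma)\neq0$. -}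

module Defs where

open import Level using (0ℓ)
open import Data.Nat using (ℕ; _∸_) renaming (_*_ to _*ℕ_)
open import Data.Fin using (Fin; zero; suc)
open import Data.List using (List; length)
open import Data.List.Membership.Propositional using (_∈_)
open import Data.List.Relation.Unary.Unique.Propositional using (Unique)
open import Data.Product using (Σ; _×_; _,_; ∃; ∃-syntax)
open import Relation.Nullary using (¬_)
open import Relation.Binary.PropositionalEquality using (_≡_; _≢_)
open import Relation.Binary.Definitions using (DecidableEquality)
open import Algebra.Structures using (IsCommutativeRing)
open import Function.Bundles using (_⇔_)

record FiniteOddField : Set₁ where
  infixl 6 _+_
  infixl 7 _*_
  field
    F    : Set
    _+_  : F → F → F
    _*_  : F → F → F
    -_   : F → F
    0#   : F
    1#   : F
    isCommutativeRing : IsCommutativeRing _≡_ _+_ _*_ -_ 0# 1#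
    0≢1  : 0# ≢ 1#
    inverse : ∀ x → x ≢ 0# → ∃[ y ] (x * y ≡ 1#)
    _≟_  : DecidableEquality F
    elements : List F
    complete : ∀ x → x ∈ elements
    unique   : Unique elements
    char≢2   : 1# + 1# ≢ 0#

  q : ℕ
  q = length elements

HasCount : {A : Set} → (A → Set) → ℕ → Set
HasCount {A} P n = Σ (List A) λ xs → Unique xs × (∀ x → (x ∈ xs) ⇔ P x) × (length xs ≡ n)

module _ (K : FiniteOddField) where
  open FiniteOddField K

  Vec3 : Set
  Vec3 = Fin 3 → F

  Mat : Set
  Mat = Fin 3 → Fin 3 → F

  sum3 : (Fin 3 → F) → F
  sum3 f = f zero + f (suc zero) + f (suc (suc zero))

  -- parameters (α,β,γ) of a point of a plane (vector representative)
  Triple : Set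
  Triple = F × F × F

  NonZeroTriple : Triple → Set
  NonZeroTriple (a , b , c) = ¬ (a ≡ 0# × b ≡ 0# × c ≡ 0#)

  NonZeroVec : Vec3 → Set
  NonZeroVec x = ¬ (∀ i → x i ≡ 0#)

  matMul : Mat → Mat → Mat
  matMul A B i j = sum3 λ k → A i k * B k j

  transpose : Mat → Mat
  transpose A i j = A j i

  identity : Mat
  identity zero zero = 1#
  identity (suc zero) (suc zero) = 1#
  identity (suc (suc zero)) (suc (suc zero)) = 1#
  identity _ _ = 0#

  -- A represents an element of PGL(3,q): A is invertible
  Invertible : Mat → Set
  Invertible A = ∃[ B ] (∀ i j → matMul A B i j ≡ identity i j)

  -- action of K = PGL(3,q): M ↦ A M A^T
  act : Mat → Mat → Mat
  act A M = matMul (matMul A M) (transpose A)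

  sigma11 : Triple → Mat
  sigma11 (α , β , γ) zero zero = 0#
  sigma11 (α , β , γ) zero (suc zero) = β
  sigma11 (α , β , γ) zero (suc (suc zero)) = γ
  sigma11 (α , β , γ) (suc zero) zero = β
  sigma11 (α , β , γ) (suc zero) (suc zero) = α
  sigma11 (α , β , γ) (suc zero) (suc (suc zero)) = α
  sigma11 (α , β , γ) (suc (suc zero)) zero = γ
  sigma11 (α , β , γ) (suc (suc zero)) (suc zero) = α
  sigma11 (α , β , γ) (suc (suc zero)) (suc (suc zero)) = α + γ

  IsZeroMat : Mat → Set
  IsZeroMat M = ∀ i j → M i j ≡ 0#

  AllMinors2Vanish : Mat → Set
  AllMinors2Vanish M = ∀ i j k l → M i k * M j l ≡ M i l * M j k

  det : Mat → F
  det M = sum3 λ j → M zero j * cof j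
    where
    m : Fin 3 → Fin 3 → Fin 3 → Fin 3 → F
    m i j k l = M i k * M j l + - (M i l * M j k)
    z o t : Fin 3
    z = zero
    o = suc zero
    t = suc (suc zero)
    cof : Fin 3 → F
    cof zero = m o t o t
    cof (suc zero) = - (m o t z t)
    cof (suc (suc zero)) = m o t z o

  Rank1 Rank2 Rank3 : Mat → Set
  Rank1 M = ¬ IsZeroMat M × AllMinors2Vanish M
  Rank2 M = ¬ IsZeroMat M × ¬ AllMinors2Vanish M × det M ≡ 0#
  Rank3 M = det M ≢ 0#

  matVec : Mat → Vec3 → Vec3
  matVec M v i = sum3 λ k → M i k * v k

  -- x lies in the column space of M, i.e. x spans a point of the line of
  -- PG(2,q) whose Veronese image is the conic C_M
  InColSpace : Mat → Vec3 → Set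
  InColSpace M x = ∃[ v ] (∀ i → matVec M v i ≡ x i)

  LinIndep : Vec3 → Vec3 → Set
  LinIndep x y = ∀ a b → (∀ i → a * x i + b * y i ≡ 0#) → a ≡ 0# × b ≡ 0#

  -- M lies on the tangent to the conic C_M at the point ν(x) = x x^T, i.e. on
  -- the line spanned by x x^T and x y^T + y x^T (x, y a basis of the line of C_M)
  OnTangentOfItsConic : Mat → Set
  OnTangentOfItsConic M =
    ∃[ x ] ∃[ y ] ∃[ λ' ] ∃[ μ ]
      (InColSpace M x × InColSpace M y × LinIndep x y ×
       (∀ i j → M i j ≡ λ' * (x i * x j) + μ * (x i * y j + y i * x j)))

  Exterior Interior : Mat → Set
  Exterior M = Rank2 M × OnTangentOfItsConic M
  Interior M = Rank2 M × ¬ OnTangentOfItsConic M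

  -- Every point of the plane has exactly (q-1) nonzero
  -- parameter vectors, hence the counts of nonzero parameters are nᵢ·(q-1).
  PointOrbitDistribution : (Triple → Mat) → ℕ → ℕ → ℕ → ℕ → Set
  PointOrbitDistribution f n1 n2 n3 n4 =
    HasCount (λ t → NonZeroTriple t × Rank1 (f t)) (n1 *ℕ (q ∸ 1)) ×
    HasCount (λ t → NonZeroTriple t × Exterior (f t)) (n2 *ℕ (q ∸ 1)) ×
    HasCount (λ t → NonZeroTriple t × Interior (f t)) (n3 *ℕ (q ∸ 1)) ×
    HasCount (λ t → NonZeroTriple t × Rank3 (f t)) (n4 *ℕ (q ∸ 1))

-- Write σ(α,β,γ) for the matrices of the plane. Its determinant is affine in α,
-- det σ = -(β-γ)² α - β² γ. For β = γ = 0 we get α·uuᵀ with u = (0,1,1): the one point of rank 1.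
-- For (β,γ) ≠ (0,0) and β ≠ γ the determinant vanishes for exactly one α, and there
-- xyᵀ + yxᵀ = 2(β-γ)² σ for the columns x = (0,β,γ), y = (2(β-γ)², -βγ, γ²-2βγ) of σ,
-- so σ lies on the tangent at ν(x) of its conic: these q points are exterior. For β = γ ≠ 0
-- the determinant is -β³ ≠ 0, so all remaining q² points have rank 3. Rank and lying on a
-- tangent of one's own conic survive M ↦ A M Aᵀ, because adj(A) A M Aᵀ adj(A)ᵀ = (det A)² M.
-- Counting parameter triples fibre by fibre over (β,γ) gives (q-1)·[1, q, 0, q²].

module Submission where

open import Level using (0ℓ)
open import Function.Base using (_∘_)
open import Function.Bundles using (_⇔_; mk⇔; Equivalence)
open import Relation.Binary.PropositionalEquality
open import Relation.Nullary using (¬_; Dec; yes; no)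
open import Relation.Nullary.Decidable using (_×-dec_; ¬?)
open import Relation.Unary using (Decidable)
open import Data.Empty using (⊥-elim)
open import Data.Product using (_×_; _,_; proj₁; proj₂; ∃-syntax)
open import Data.Sum using (_⊎_; inj₁; inj₂; [_,_]′)
open import Data.Maybe using (Maybe; just; nothing)
open import Data.Nat as ℕ using (ℕ)
import Data.Nat.Properties as ℕ
open import Data.Nat.ListAction using (sum)
open import Data.Nat.ListAction.Properties using (sum-++)
open import Data.Nat.Tactic.RingSolver using (solve-∀)
open import Data.Integer as ℤ using (ℤ; -[1+_]; _⊖_; ∣_∣; sign; _◃_)
import Data.Integer.Properties as ℤ
open import Data.Sign as Sign using (Sign)
open import Data.Fin using (Fin; combine; _↑ˡ_; _↑ʳ_)
open import Data.Fin.Patterns using (0F; 1F; 2F; 3F; 4F)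
open import Data.Vec using (Vec; []; _∷_; _++_)
open import Data.List as List using (List; []; _∷_; length; filter; map; cartesianProductWith; cartesianProduct)
open import Data.List.Properties using (map-++; map-∘; map-cong)
open import Data.List.Membership.Propositional using (_∈_)
open import Data.List.Membership.Propositional.Properties
  using (∈-filter⁺; ∈-filter⁻; ∈-cartesianProductWith⁺; ∈-cartesianProduct⁺)
open import Data.List.Relation.Unary.Any using (here; there)
import Data.List.Relation.Unary.All as All
open import Data.List.Relation.Unary.AllPairs using ([]; _∷_)
open import Data.List.Relation.Unary.Unique.Propositional using (Unique)
open import Data.List.Relation.Unary.Unique.Propositional.Properties
  using (filter⁺; cartesianProductWith⁺; cartesianProduct⁺)
open import Algebra.Core using (Op₁; Op₂)
open import Algebra.Bundles using (CommutativeRing)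
open import Algebra.Bundles.Raw using (RawRing)
open import Algebra.Structures using (IsCommutativeRing)
import Algebra.Solver.Ring
import Algebra.Solver.Ring.AlmostCommutativeRing as ACR
open import Algebra.Properties.CommutativeSemigroup ℕ.+-commutativeSemigroup using (x∙yz≈y∙xz)

module IntegerCoefficientSolver
  {A : Set} {add mul : Op₂ A} {neg : Op₁ A} {zero one : A}
  (isCommutativeRing : IsCommutativeRing _≡_ add mul neg zero one) where

  ring : CommutativeRing 0ℓ 0ℓ
  ring = record { isCommutativeRing = isCommutativeRing }

  open CommutativeRing ring
    using (_+_; _*_; -_; 0#; 1#; +-assoc; +-comm; +-identityˡ; +-identityʳ; *-identityˡ; *-identityʳ;
           zeroˡ; zeroʳ; distribʳ; -‿inverseʳ; +-group; +-abelianGroup; *-commutativeSemigroup)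
    renaming (ring to ring′)
  open import Algebra.Properties.Ring ring′ using (-1*x≈-x)
  open import Algebra.Properties.CommutativeSemigroup *-commutativeSemigroup using (interchange)
  open import Algebra.Properties.AbelianGroup +-abelianGroup using (⁻¹-∙-comm)
  open import Algebra.Properties.Group +-group using (ε⁻¹≈ε; ⁻¹-involutive)

  -- Unlike n × 1#, this sends 0, 1 and 2 to 0#, 1# and 1# + 1# definitionally, so the solver's
  -- constants evaluate to exactly the expressions that occur in Defs.
  fromℕ : ℕ → A
  fromℕ 0 = 0#
  fromℕ 1 = 1#
  fromℕ (ℕ.suc (ℕ.suc n)) = 1# + fromℕ (ℕ.suc n)

  fromℕ-suc : ∀ n → fromℕ (ℕ.suc n) ≡ 1# + fromℕ n
  fromℕ-suc 0 = sym (+-identityʳ 1#)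
  fromℕ-suc (ℕ.suc n) = refl

  fromℕ-+ : ∀ m n → fromℕ (m ℕ.+ n) ≡ fromℕ m + fromℕ n
  fromℕ-+ 0 n = sym (+-identityˡ _)
  fromℕ-+ (ℕ.suc m) n = begin
    fromℕ (ℕ.suc (m ℕ.+ n))  ≡⟨ fromℕ-suc (m ℕ.+ n) ⟩
    1# + fromℕ (m ℕ.+ n)     ≡⟨ cong (1# +_) (fromℕ-+ m n) ⟩
    1# + (fromℕ m + fromℕ n) ≡⟨ sym (+-assoc _ _ _) ⟩
    (1# + fromℕ m) + fromℕ n ≡⟨ cong (_+ fromℕ n) (sym (fromℕ-suc m)) ⟩
    fromℕ (ℕ.suc m) + fromℕ n ∎
    where open ≡-Reasoning

  fromℕ-* : ∀ m n → fromℕ (m ℕ.* n) ≡ fromℕ m * fromℕ n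
  fromℕ-* 0 n = sym (zeroˡ _)
  fromℕ-* (ℕ.suc m) n = begin
    fromℕ (n ℕ.+ m ℕ.* n)           ≡⟨ fromℕ-+ n (m ℕ.* n) ⟩
    fromℕ n + fromℕ (m ℕ.* n)       ≡⟨ cong₂ _+_ (sym (*-identityˡ _)) (fromℕ-* m n) ⟩
    1# * fromℕ n + fromℕ m * fromℕ n ≡⟨ sym (distribʳ _ _ _) ⟩
    (1# + fromℕ m) * fromℕ n        ≡⟨ cong (_* fromℕ n) (sym (fromℕ-suc m)) ⟩
    fromℕ (ℕ.suc m) * fromℕ n       ∎
    where open ≡-Reasoning

  fromℤ : ℤ → A
  fromℤ (ℤ.+ n) = fromℕ n
  fromℤ -[1+ n ] = - fromℕ (ℕ.suc n)

  fromℤ-⊖ : ∀ m n → fromℤ (m ⊖ n) ≡ fromℕ m + - fromℕ n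
  fromℤ-⊖ 0 0 = sym (trans (+-identityˡ _) ε⁻¹≈ε)
  fromℤ-⊖ 0 (ℕ.suc n) = sym (+-identityˡ _)
  fromℤ-⊖ (ℕ.suc m) 0 = sym (trans (cong (fromℕ (ℕ.suc m) +_) ε⁻¹≈ε) (+-identityʳ _))
  fromℤ-⊖ (ℕ.suc m) (ℕ.suc n) = begin
    fromℤ (ℕ.suc m ⊖ ℕ.suc n)              ≡⟨ cong fromℤ (ℤ.[1+m]⊖[1+n]≡m⊖n m n) ⟩
    fromℤ (m ⊖ n)                          ≡⟨ fromℤ-⊖ m n ⟩
    fromℕ m + - fromℕ n                    ≡⟨ cancel-1 (fromℕ m) (fromℕ n) ⟩
    (1# + fromℕ m) + - (1# + fromℕ n)      ≡⟨ sym (cong₂ (λ a b → a + - b) (fromℕ-suc m) (fromℕ-suc n)) ⟩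
    fromℕ (ℕ.suc m) + - fromℕ (ℕ.suc n)    ∎
    where
    open ≡-Reasoning
    cancel-1 : ∀ x y → x + - y ≡ (1# + x) + - (1# + y)
    cancel-1 x y = begin
      x + - y                 ≡⟨ sym (+-identityˡ _) ⟩
      0# + (x + - y)          ≡⟨ cong (_+ (x + - y)) (sym (-‿inverseʳ 1#)) ⟩
      (1# + - 1#) + (x + - y) ≡⟨ +-assoc 1# (- 1#) _ ⟩
      1# + (- 1# + (x + - y)) ≡⟨ cong (1# +_) (sym (+-assoc (- 1#) x (- y))) ⟩
      1# + ((- 1# + x) + - y) ≡⟨ cong (λ z → 1# + (z + - y)) (+-comm (- 1#) x) ⟩
      1# + ((x + - 1#) + - y) ≡⟨ cong (1# +_) (+-assoc x (- 1#) (- y)) ⟩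
      1# + (x + (- 1# + - y)) ≡⟨ cong (λ z → 1# + (x + z)) (⁻¹-∙-comm 1# y) ⟩
      1# + (x + - (1# + y))   ≡⟨ sym (+-assoc 1# x _) ⟩
      (1# + x) + - (1# + y)   ∎

  fromℤ-+ : ∀ i j → fromℤ (i ℤ.+ j) ≡ fromℤ i + fromℤ j
  fromℤ-+ (ℤ.+ m) (ℤ.+ n) = fromℕ-+ m n
  fromℤ-+ (ℤ.+ m) -[1+ n ] = fromℤ-⊖ m (ℕ.suc n)
  fromℤ-+ -[1+ m ] (ℤ.+ n) = trans (fromℤ-⊖ n (ℕ.suc m)) (+-comm _ _)
  fromℤ-+ -[1+ m ] -[1+ n ] = begin
    - fromℕ (ℕ.suc (ℕ.suc (m ℕ.+ n)))        ≡⟨ cong (λ k → - fromℕ (ℕ.suc k)) (sym (ℕ.+-suc m n)) ⟩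
    - fromℕ (ℕ.suc m ℕ.+ ℕ.suc n)            ≡⟨ cong -_ (fromℕ-+ (ℕ.suc m) (ℕ.suc n)) ⟩
    - (fromℕ (ℕ.suc m) + fromℕ (ℕ.suc n))    ≡⟨ sym (⁻¹-∙-comm _ _) ⟩
    - fromℕ (ℕ.suc m) + - fromℕ (ℕ.suc n)    ∎
    where open ≡-Reasoning

  fromSign : Sign → A
  fromSign Sign.+ = 1#
  fromSign Sign.- = - 1#

  fromSign-* : ∀ s t → fromSign (s Sign.* t) ≡ fromSign s * fromSign t
  fromSign-* Sign.+ t = sym (*-identityˡ _)
  fromSign-* Sign.- Sign.+ = sym (*-identityʳ _)
  fromSign-* Sign.- Sign.- = sym (trans (-1*x≈-x (- 1#)) (⁻¹-involutive 1#))

  fromℤ-◃ : ∀ s n → fromℤ (s ◃ n) ≡ fromSign s * fromℕ n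
  fromℤ-◃ s 0 = sym (zeroʳ _)
  fromℤ-◃ Sign.+ (ℕ.suc n) = sym (*-identityˡ _)
  fromℤ-◃ Sign.- (ℕ.suc n) = sym (-1*x≈-x _)

  fromℤ-sign : ∀ i → fromℤ i ≡ fromSign (sign i) * fromℕ ∣ i ∣
  fromℤ-sign i = trans (cong fromℤ (sym (ℤ.◃-inverse i))) (fromℤ-◃ (sign i) ∣ i ∣)

  fromℤ-* : ∀ i j → fromℤ (i ℤ.* j) ≡ fromℤ i * fromℤ j
  fromℤ-* i j = begin
    fromℤ (sign i Sign.* sign j ◃ ∣ i ∣ ℕ.* ∣ j ∣)                      ≡⟨ fromℤ-◃ (sign i Sign.* sign j) (∣ i ∣ ℕ.* ∣ j ∣) ⟩
    fromSign (sign i Sign.* sign j) * fromℕ (∣ i ∣ ℕ.* ∣ j ∣)            ≡⟨ cong₂ _*_ (fromSign-* (sign i) (sign j)) (fromℕ-* ∣ i ∣ ∣ j ∣) ⟩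
    (fromSign (sign i) * fromSign (sign j)) * (fromℕ ∣ i ∣ * fromℕ ∣ j ∣) ≡⟨ interchange _ _ _ _ ⟩
    (fromSign (sign i) * fromℕ ∣ i ∣) * (fromSign (sign j) * fromℕ ∣ j ∣) ≡⟨ sym (cong₂ _*_ (fromℤ-sign i) (fromℤ-sign j)) ⟩
    fromℤ i * fromℤ j                                                   ∎
    where open ≡-Reasoning

  fromℤ-neg : ∀ i → fromℤ (ℤ.- i) ≡ - fromℤ i
  fromℤ-neg (ℤ.+ 0) = sym ε⁻¹≈ε
  fromℤ-neg (ℤ.+ ℕ.suc n) = refl
  fromℤ-neg -[1+ n ] = sym (⁻¹-involutive _)

  fromℤ-homomorphism : ℤ.+-*-rawRing ACR.-Raw-AlmostCommutative⟶ ACR.fromCommutativeRing ring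
  fromℤ-homomorphism = record
    { ⟦_⟧ = fromℤ ; +-homo = fromℤ-+ ; *-homo = fromℤ-* ; -‿homo = fromℤ-neg ; 0-homo = refl ; 1-homo = refl }

  fromℤ-≟ : ∀ i j → Maybe (fromℤ i ≡ fromℤ j)
  fromℤ-≟ i j with i ℤ.≟ j
  ... | yes i≡j = just (cong fromℤ i≡j)
  ... | no _ = nothing

  open Algebra.Solver.Ring ℤ.+-*-rawRing (ACR.fromCommutativeRing ring) fromℤ-homomorphism fromℤ-≟ public


-- The operations of Defs, entry for entry the same expressions but over any raw ring: evaluating
-- them at solver polynomials unfolds definitionally to the operations of Defs.
module Matrix₃ (R : RawRing 0ℓ 0ℓ) where
  open RawRing R

  sum3 : (Fin 3 → Carrier) → Carrier
  sum3 f = f 0F + f 1F + f 2F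

  matMul : (A B : Fin 3 → Fin 3 → Carrier) → Fin 3 → Fin 3 → Carrier
  matMul A B i j = sum3 λ k → A i k * B k j

  transpose : (Fin 3 → Fin 3 → Carrier) → Fin 3 → Fin 3 → Carrier
  transpose A i j = A j i

  dot : (u v : Fin 3 → Carrier) → Carrier
  dot u v = sum3 λ k → u k * v k

  matVec : (Fin 3 → Fin 3 → Carrier) → (Fin 3 → Carrier) → Fin 3 → Carrier
  matVec M v i = dot (M i) v

  -- act A M i j unfolds to bilinear (A i) M (A j), so identities about act can be stated row by row
  bilinear : (Fin 3 → Carrier) → (Fin 3 → Fin 3 → Carrier) → (Fin 3 → Carrier) → Carrier
  bilinear u M w = sum3 λ c → dot u (λ k → M k c) * w c

  act : (A M : Fin 3 → Fin 3 → Carrier) → Fin 3 → Fin 3 → Carrier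
  act A M = matMul (matMul A M) (transpose A)

  identity : Fin 3 → Fin 3 → Carrier
  identity 0F 0F = 1#
  identity 1F 1F = 1#
  identity 2F 2F = 1#
  identity _ _ = 0#

  minor : (Fin 3 → Fin 3 → Carrier) → Fin 3 → Fin 3 → Fin 3 → Fin 3 → Carrier
  minor M i j k l = M i k * M j l + - (M i l * M j k)

  det : (Fin 3 → Fin 3 → Carrier) → Carrier
  det M = sum3 λ j → M 0F j * cofactor j
    where
    cofactor : Fin 3 → Carrier
    cofactor 0F = minor M 1F 2F 1F 2F
    cofactor 1F = - (minor M 1F 2F 0F 2F)
    cofactor 2F = minor M 1F 2F 0F 1F

  adjugate : (Fin 3 → Fin 3 → Carrier) → Fin 3 → Fin 3 → Carrier
  adjugate M 0F 0F = minor M 1F 2F 1F 2F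
  adjugate M 0F 1F = - (minor M 0F 2F 1F 2F)
  adjugate M 0F 2F = minor M 0F 1F 1F 2F
  adjugate M 1F 0F = - (minor M 1F 2F 0F 2F)
  adjugate M 1F 1F = minor M 0F 2F 0F 2F
  adjugate M 1F 2F = - (minor M 0F 1F 0F 2F)
  adjugate M 2F 0F = minor M 1F 2F 0F 1F
  adjugate M 2F 1F = - (minor M 0F 2F 0F 1F)
  adjugate M 2F 2F = minor M 0F 1F 0F 1F

module PlaneExpressions (R : RawRing 0ℓ 0ℓ) where
  open RawRing R

  vec3 : Carrier → Carrier → Carrier → Fin 3 → Carrier
  vec3 a b c 0F = a
  vec3 a b c 1F = b
  vec3 a b c 2F = c

  plane : Carrier → Carrier → Carrier → Fin 3 → Fin 3 → Carrier
  plane α β γ 0F 0F = 0#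
  plane α β γ 0F 1F = β
  plane α β γ 0F 2F = γ
  plane α β γ 1F 0F = β
  plane α β γ 1F 1F = α
  plane α β γ 1F 2F = α
  plane α β γ 2F 0F = γ
  plane α β γ 2F 1F = α
  plane α β γ 2F 2F = α + γ

  twice : Carrier → Carrier
  twice x = (1# + 1#) * x

  detSlope detOffset : Carrier → Carrier → Carrier
  detSlope β γ = - ((β + - γ) * (β + - γ))
  detOffset β γ = - (β * β * γ)

  axis : Fin 3 → Carrier
  axis = vec3 0# 1# 1#

  tangency : Carrier → Carrier → Carrier
  tangency β γ = twice ((β + - γ) * (β + - γ))

  columnˣ columnʸ preimageʸ : Carrier → Carrier → Fin 3 → Carrier
  columnˣ β γ = vec3 0# β γ
  columnʸ β γ = vec3 (tangency β γ) (- (β * γ)) (γ * γ + - twice (β * γ))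
  preimageʸ β γ = vec3 (- γ) (twice (β + - γ)) (- twice (β + - γ))

  preimageˣ : Fin 3 → Carrier
  preimageˣ = vec3 1# 0# 0#

open import Defs

allIndices : {P : Fin 3 → Set} → P 0F → P 1F → P 2F → ∀ i → P i
allIndices p₀ p₁ p₂ 0F = p₀
allIndices p₀ p₁ p₂ 1F = p₁
allIndices p₀ p₁ p₂ 2F = p₂

allEntries : {P : Fin 3 → Fin 3 → Set} →
  P 0F 0F → P 0F 1F → P 0F 2F → P 1F 0F → P 1F 1F → P 1F 2F → P 2F 0F → P 2F 1F → P 2F 2F →
  ∀ i j → P i j
allEntries p₀₀ p₀₁ p₀₂ p₁₀ p₁₁ p₁₂ p₂₀ p₂₁ p₂₂ =
  allIndices (allIndices p₀₀ p₀₁ p₀₂) (allIndices p₁₀ p₁₁ p₁₂) (allIndices p₂₀ p₂₁ p₂₂)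

indicator : {P : Set} → Dec P → ℕ
indicator (yes _) = 1
indicator (no _) = 0

indicator-yes : {P : Set} (P? : Dec P) → P → indicator P? ≡ 1
indicator-yes (yes _) _ = refl
indicator-yes (no ¬p) p = ⊥-elim (¬p p)

indicator-no : {P : Set} (P? : Dec P) → ¬ P → indicator P? ≡ 0
indicator-no (yes p) ¬p = ⊥-elim (¬p p)
indicator-no (no _) _ = refl

module _ {A : Set} where

  ∈⇒length≡suc[length∸1] : ∀ {x : A} {xs} → x ∈ xs → length xs ≡ ℕ.suc (length xs ℕ.∸ 1)
  ∈⇒length≡suc[length∸1] {xs = _ ∷ _} _ = refl

  length-filter≡sum-indicator : {P : A → Set} (P? : Decidable P) (xs : List A) →
    length (filter P? xs) ≡ sum (map (λ x → indicator (P? x)) xs)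
  length-filter≡sum-indicator P? [] = refl
  length-filter≡sum-indicator P? (x ∷ xs) with P? x
  ... | yes _ = cong ℕ.suc (length-filter≡sum-indicator P? xs)
  ... | no _ = length-filter≡sum-indicator P? xs

  sum-map-cartesianProductWith : {B C : Set} (f : A → B → C) (g : C → ℕ) (xs : List A) (ys : List B) →
    sum (map g (cartesianProductWith f xs ys)) ≡ sum (map (λ x → sum (map (λ y → g (f x y)) ys)) xs)
  sum-map-cartesianProductWith f g [] ys = refl
  sum-map-cartesianProductWith f g (x ∷ xs) ys = begin
    sum (map g (map (f x) ys List.++ cartesianProductWith f xs ys))
      ≡⟨ cong sum (map-++ g (map (f x) ys) _) ⟩
    sum (map g (map (f x) ys) List.++ map g (cartesianProductWith f xs ys))
      ≡⟨ sum-++ (map g (map (f x) ys)) _ ⟩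
    sum (map g (map (f x) ys)) ℕ.+ sum (map g (cartesianProductWith f xs ys))
      ≡⟨ cong₂ ℕ._+_ (cong sum (sym (map-∘ ys))) (sum-map-cartesianProductWith f g xs ys) ⟩
    sum (map (λ y → g (f x y)) ys) ℕ.+ sum (map (λ x → sum (map (λ y → g (f x y)) ys)) xs)
      ∎
    where open ≡-Reasoning

  sum-map-const : (g : A → ℕ) {k : ℕ} (xs : List A) → (∀ {x} → x ∈ xs → g x ≡ k) → sum (map g xs) ≡ length xs ℕ.* k
  sum-map-const g [] _ = refl
  sum-map-const g (x ∷ xs) g≡k = cong₂ ℕ._+_ (g≡k (here refl)) (sum-map-const g xs (λ x∈xs → g≡k (there x∈xs)))

  sum-map-except : (g : A → ℕ) {k : ℕ} {c : A} {xs : List A} → Unique xs → c ∈ xs → (∀ x → x ≢ c → g x ≡ k) →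
    sum (map g xs) ≡ g c ℕ.+ (length xs ℕ.∸ 1) ℕ.* k
  sum-map-except g {xs = y ∷ ys} (y∉ys ∷ _) (here refl) g≡k =
    cong (g y ℕ.+_) (sum-map-const g ys (λ {x} x∈ys → g≡k x (λ x≡y → All.lookup y∉ys x∈ys (sym x≡y))))
  sum-map-except g {k} {c} {xs = y ∷ z ∷ zs} (y∉ys ∷ unique-ys) (there c∈ys) g≡k = begin
    g y ℕ.+ sum (map g (z ∷ zs))                   ≡⟨ cong₂ ℕ._+_ (g≡k y y≢c) (sum-map-except g unique-ys c∈ys g≡k) ⟩
    k ℕ.+ (g c ℕ.+ length zs ℕ.* k)               ≡⟨ x∙yz≈y∙xz k (g c) _ ⟩
    g c ℕ.+ (k ℕ.+ length zs ℕ.* k)               ∎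
    where
    open ≡-Reasoning
    y≢c : y ≢ c
    y≢c = All.lookup y∉ys c∈ys

module _ (K : FiniteOddField) where
  open FiniteOddField K
  open IsCommutativeRing isCommutativeRing
    using (+-identityˡ; +-identityʳ; *-assoc; *-comm; *-identityˡ; zeroˡ; zeroʳ; -‿inverseˡ)
  open IntegerCoefficientSolver isCommutativeRing
    using (Polynomial; var; con; _:+_; _:*_; :-_; prove; ring)
  open CommutativeRing ring using (+-group)
  open import Algebra.Properties.Group +-group using (x∙y⁻¹≈ε⇒x≈y; x≈y⇒x∙y⁻¹≈ε; ε⁻¹≈ε; ⁻¹-involutive)
  open import Algebra.Properties.CommutativeSemigroup (CommutativeRing.*-commutativeSemigroup ring)
    using (interchange)

  scalars : RawRing 0ℓ 0ℓ
  scalars = record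
    { Carrier = F ; _≈_ = _≡_ ; _+_ = _+_ ; _*_ = _*_ ; -_ = -_ ; 0# = 0# ; 1# = 1# }

  polynomials : ℕ → RawRing 0ℓ 0ℓ
  polynomials n = record
    { Carrier = Polynomial n ; _≈_ = _≡_ ; _+_ = _:+_ ; _*_ = _:*_ ; -_ = :-_
    ; 0# = con (ℤ.+ 0) ; 1# = con (ℤ.+ 1) }

  open Matrix₃ scalars using (adjugate; minor)
  private module P {n} = Matrix₃ (polynomials n)
  open PlaneExpressions scalars
  private module Pσ {n} = PlaneExpressions (polynomials n)

  -- The solver's variables are the entries of the matrices and vectors involved, listed in the
  -- environment block after block; the block starting at position o of an environment with r
  -- entries after the block is addressed by o ↑ʳ (k ↑ˡ r).

  matVar : ∀ {n} → (Fin 9 → Fin n) → Fin 3 → Fin 3 → Polynomial n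
  matVar at i j = var (at (combine i j))

  vecVar : ∀ {n} → (Fin 3 → Fin n) → Fin 3 → Polynomial n
  vecVar at i = var (at i)

  entries : Mat K → Vec F 9
  entries A = A 0F 0F ∷ A 0F 1F ∷ A 0F 2F ∷ A 1F 0F ∷ A 1F 1F ∷ A 1F 2F ∷ A 2F 0F ∷ A 2F 1F ∷ A 2F 2F ∷ []

  coords : Vec3 K → Vec F 3
  coords v = v 0F ∷ v 1F ∷ v 2F ∷ []

  det-matMul : ∀ A B → det K (matMul K A B) ≡ det K A * det K B
  det-matMul A B = prove (entries A ++ entries B) (P.det (P.matMul X Y)) (P.det X :* P.det Y) refl
    where
    X Y : Fin 3 → Fin 3 → Polynomial 18
    X = matVar (_↑ˡ 9)
    Y = matVar (9 ↑ʳ_)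

  det-transpose : ∀ A → det K (transpose K A) ≡ det K A
  det-transpose A = prove (entries A) (P.det (P.transpose X)) (P.det X) refl
    where
    X : Fin 3 → Fin 3 → Polynomial 9
    X = matVar (λ k → k)

  det-identity : det K (identity K) ≡ 1#
  det-identity = prove [] (P.det P.identity) (con (ℤ.+ 1)) refl

  act-adjugate : ∀ A M i j → act K (adjugate A) (act K A M) i j ≡ (det K A * det K A) * M i j
  act-adjugate A M = allEntries (s 0F 0F refl) (s 0F 1F refl) (s 0F 2F refl) (s 1F 0F refl) (s 1F 1F refl)
                                (s 1F 2F refl) (s 2F 0F refl) (s 2F 1F refl) (s 2F 2F refl)
    where
    X Y : Fin 3 → Fin 3 → Polynomial 18
    X = matVar (_↑ˡ 9)
    Y = matVar (9 ↑ʳ_)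
    s = λ i j → prove (entries A ++ entries M) (P.act (P.adjugate X) (P.act X Y) i j) (P.det X :* P.det X :* Y i j)

  adjugate-matVec : ∀ A v i → matVec K (adjugate A) (matVec K A v) i ≡ det K A * v i
  adjugate-matVec A v = allIndices (s 0F refl) (s 1F refl) (s 2F refl)
    where
    X = matVar {12} (_↑ˡ 3)
    x = vecVar {12} (9 ↑ʳ_)
    s = λ i → prove (entries A ++ coords v) (P.matVec (P.adjugate X) (P.matVec X x) i) (P.det X :* x i)

  transpose-adjugate-matVec : ∀ A e v i →
    matVec K (transpose K A) (λ k → e * matVec K (transpose K (adjugate A)) v k) i ≡ (e * det K A) * v i
  transpose-adjugate-matVec A e v = allIndices (s 0F refl) (s 1F refl) (s 2F refl)
    where
    X = matVar {13} (_↑ˡ 4)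
    x = vecVar {13} (λ k → 9 ↑ʳ (k ↑ˡ 1))
    ε = var {13} (12 ↑ʳ 0F)
    s = λ i → prove (entries A ++ coords v ++ e ∷ [])
      (P.matVec (P.transpose X) (λ k → ε :* P.matVec (P.transpose (P.adjugate X)) x k) i) (ε :* P.det X :* x i)

  minor-act : ∀ Q M i j k l → minor (act K Q M) i j k l ≡
    sum3 K λ a → sum3 K λ b → sum3 K λ c → sum3 K λ e → (Q i a * Q j b) * (Q k c * Q l e) * minor M a b c e
  minor-act Q M i j k l =
    prove (coords (Q i) ++ coords (Q j) ++ coords (Q k) ++ coords (Q l) ++ entries M)
      (P.bilinear qi Y qk :* P.bilinear qj Y ql :+ :- (P.bilinear qi Y ql :* P.bilinear qj Y qk))
      (P.sum3 λ a → P.sum3 λ b → P.sum3 λ c → P.sum3 λ e → (qi a :* qj b) :* (qk c :* ql e) :* P.minor Y a b c e)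
      refl
    where
    qi qj qk ql : Fin 3 → Polynomial 21
    qi = vecVar (_↑ˡ 18)
    qj = vecVar (λ r → 3 ↑ʳ (r ↑ˡ 15))
    qk = vecVar (λ r → 6 ↑ʳ (r ↑ˡ 12))
    ql = vecVar (λ r → 9 ↑ʳ (r ↑ˡ 9))
    Y = matVar (12 ↑ʳ_)

  matVec-act : ∀ A M w i → matVec K (act K A M) w i ≡ matVec K A (matVec K M (matVec K (transpose K A) w)) i
  matVec-act A M w i =
    prove (coords (A i) ++ entries A ++ entries M ++ coords w)
      (P.dot (λ j → P.bilinear a Y (X j)) x) (P.dot a (P.matVec Y (P.matVec (P.transpose X) x))) refl
    where
    a = vecVar {24} (_↑ˡ 21)
    X = matVar {24} (λ r → 3 ↑ʳ (r ↑ˡ 12))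
    Y = matVar {24} (λ r → 12 ↑ʳ (r ↑ˡ 3))
    x = vecVar {24} (21 ↑ʳ_)

  matVec-linear : ∀ A p r x y i → matVec K A (λ k → p * x k + r * y k) i ≡ p * matVec K A x i + r * matVec K A y i
  matVec-linear A p r x y i =
    prove (coords (A i) ++ coords x ++ coords y ++ p ∷ r ∷ [])
      (P.dot a (λ k → π :* u k :+ ϱ :* v k)) (π :* P.dot a u :+ ϱ :* P.dot a v) refl
    where
    a = vecVar {11} (_↑ˡ 8)
    u = vecVar {11} (λ k → 3 ↑ʳ (k ↑ˡ 5))
    v = vecVar {11} (λ k → 6 ↑ʳ (k ↑ˡ 2))
    π = var {11} (9 ↑ʳ 0F)
    ϱ = var {11} (9 ↑ʳ 1F)

  TangentForm : F → F → Vec3 K → Vec3 K → Mat K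
  TangentForm λ′ μ x y i j = λ′ * (x i * x j) + μ * (x i * y j + y i * x j)

  act-TangentForm : ∀ A λ′ μ x y i j →
    act K A (TangentForm λ′ μ x y) i j ≡ TangentForm λ′ μ (matVec K A x) (matVec K A y) i j
  act-TangentForm A λ′ μ x y i j =
    prove (coords (A i) ++ coords (A j) ++ coords x ++ coords y ++ λ′ ∷ μ ∷ [])
      (P.bilinear a T b)
      (Λ :* (P.dot a u :* P.dot b u) :+ Μ :* (P.dot a u :* P.dot b v :+ P.dot a v :* P.dot b u)) refl
    where
    a = vecVar {14} (_↑ˡ 11)
    b = vecVar {14} (λ k → 3 ↑ʳ (k ↑ˡ 8))
    u = vecVar {14} (λ k → 6 ↑ʳ (k ↑ˡ 5))
    v = vecVar {14} (λ k → 9 ↑ʳ (k ↑ˡ 2))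
    Λ = var {14} (12 ↑ʳ 0F)
    Μ = var {14} (12 ↑ʳ 1F)
    T : Fin 3 → Fin 3 → Polynomial 14
    T k l = Λ :* (u k :* u l) :+ Μ :* (u k :* v l :+ v k :* u l)

  sigma11-det : ∀ α β γ → det K (sigma11 K (α , β , γ)) ≡ detSlope β γ * α + detOffset β γ
  sigma11-det α β γ = prove (α ∷ β ∷ γ ∷ []) (P.det (Pσ.plane a b c)) (Pσ.detSlope b c :* a :+ Pσ.detOffset b c) refl
    where
    a b c : Polynomial 3
    a = var 0F
    b = var 1F
    c = var 2F

  sigma11-axis : ∀ α i j → sigma11 K (α , 0# , 0#) i j ≡ α * (axis i * axis j)
  sigma11-axis α = allEntries (s 0F 0F refl) (s 0F 1F refl) (s 0F 2F refl) (s 1F 0F refl) (s 1F 1F refl)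
                              (s 1F 2F refl) (s 2F 0F refl) (s 2F 1F refl) (s 2F 2F refl)
    where
    a = var {1} 0F
    o = con {1} (ℤ.+ 0)
    s = λ i j → prove (α ∷ []) (Pσ.plane a o o i j) (a :* (Pσ.axis i :* Pσ.axis j))

  sigma11-tangency : ∀ α β γ i j →
    columnˣ β γ i * columnʸ β γ j + columnʸ β γ i * columnˣ β γ j ≡
    tangency β γ * sigma11 K (α , β , γ) i j + twice (detSlope β γ * α + detOffset β γ) * (axis i * axis j)
  sigma11-tangency α β γ = allEntries (s 0F 0F refl) (s 0F 1F refl) (s 0F 2F refl) (s 1F 0F refl) (s 1F 1F refl)
                                      (s 1F 2F refl) (s 2F 0F refl) (s 2F 1F refl) (s 2F 2F refl)
    where
    a = var {3} 0F
    b = var {3} 1F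
    c = var {3} 2F
    s = λ i j → prove (α ∷ β ∷ γ ∷ [])
      (Pσ.columnˣ b c i :* Pσ.columnʸ b c j :+ Pσ.columnʸ b c i :* Pσ.columnˣ b c j)
      (Pσ.tangency b c :* Pσ.plane a b c i j :+ Pσ.twice (Pσ.detSlope b c :* a :+ Pσ.detOffset b c) :* (Pσ.axis i :* Pσ.axis j))

  sigma11-columnˣ : ∀ α β γ i → matVec K (sigma11 K (α , β , γ)) preimageˣ i ≡ columnˣ β γ i
  sigma11-columnˣ α β γ = allIndices (s 0F refl) (s 1F refl) (s 2F refl)
    where
    a = var {3} 0F
    b = var {3} 1F
    c = var {3} 2F
    s = λ i → prove (α ∷ β ∷ γ ∷ []) (P.matVec (Pσ.plane a b c) Pσ.preimageˣ i) (Pσ.columnˣ b c i)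

  sigma11-columnʸ : ∀ α β γ i → matVec K (sigma11 K (α , β , γ)) (preimageʸ β γ) i ≡ columnʸ β γ i
  sigma11-columnʸ α β γ = allIndices (s 0F refl) (s 1F refl) (s 2F refl)
    where
    a = var {3} 0F
    b = var {3} 1F
    c = var {3} 2F
    s = λ i → prove (α ∷ β ∷ γ ∷ []) (P.matVec (Pσ.plane a b c) (Pσ.preimageʸ b c) i) (Pσ.columnʸ b c i)

  scaledOuter-minor : ∀ c a b d e → (c * (a * d)) * (c * (b * e)) ≡ (c * (a * e)) * (c * (b * d))
  scaledOuter-minor c a b d e = prove (c ∷ a ∷ b ∷ d ∷ e ∷ [])
    (γ :* (x :* u) :* (γ :* (y :* v))) (γ :* (x :* v) :* (γ :* (y :* u))) refl
    where
    γ x y u v : Polynomial 5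
    γ = var 0F
    x = var 1F
    y = var 2F
    u = var 3F
    v = var 4F

  detSlope-diagonal : ∀ β → detSlope β β ≡ 0#
  detSlope-diagonal β = prove (β ∷ []) (Pσ.detSlope b b) (con (ℤ.+ 0)) refl
    where
    b = var {1} 0F

  x-y≡0⇒x≡y : ∀ {x y} → x + - y ≡ 0# → x ≡ y
  x-y≡0⇒x≡y = x∙y⁻¹≈ε⇒x≈y _ _

  x≡y⇒x-y≡0 : ∀ {x y} → x ≡ y → x + - y ≡ 0#
  x≡y⇒x-y≡0 = x≈y⇒x∙y⁻¹≈ε

  -x≡0⇒x≡0 : ∀ {x} → - x ≡ 0# → x ≡ 0#
  -x≡0⇒x≡0 {x} -x≡0 = trans (sym (⁻¹-involutive x)) (trans (cong -_ -x≡0) ε⁻¹≈ε)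

  *-cancelˡ : ∀ {c x y} → c ≢ 0# → c * x ≡ c * y → x ≡ y
  *-cancelˡ {c} {x} {y} c≢0 cx≡cy = begin
    x             ≡⟨ undo x ⟩
    w * (c * x)   ≡⟨ cong (w *_) cx≡cy ⟩
    w * (c * y)   ≡⟨ sym (undo y) ⟩
    y             ∎
    where
    open ≡-Reasoning
    w = proj₁ (inverse c c≢0)
    undo : ∀ z → z ≡ w * (c * z)
    undo z = begin
      z             ≡⟨ sym (*-identityˡ z) ⟩
      1# * z        ≡⟨ cong (_* z) (sym (proj₂ (inverse c c≢0))) ⟩
      (c * w) * z   ≡⟨ cong (_* z) (*-comm c w) ⟩
      (w * c) * z   ≡⟨ *-assoc w c z ⟩
      w * (c * z)   ∎

  x*y≡0⇒y≡0 : ∀ {x y} → x ≢ 0# → x * y ≡ 0# → y ≡ 0#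
  x*y≡0⇒y≡0 {x} x≢0 xy≡0 = *-cancelˡ x≢0 (trans xy≡0 (sym (zeroʳ x)))

  x*y≢0 : ∀ {x y} → x ≢ 0# → y ≢ 0# → x * y ≢ 0#
  x*y≢0 x≢0 y≢0 xy≡0 = y≢0 (x*y≡0⇒y≡0 x≢0 xy≡0)

  x*x≡0⇒x≡0 : ∀ {x} → x * x ≡ 0# → x ≡ 0#
  x*x≡0⇒x≡0 {x} xx≡0 with x ≟ 0#
  ... | yes x≡0 = x≡0
  ... | no x≢0 = x*y≡0⇒y≡0 x≢0 xx≡0

  linear-root : ∀ {s} o → s ≢ 0# → ∃[ r ] (s * r + o ≡ 0# × ∀ a → s * a + o ≡ 0# → a ≡ r)
  linear-root {s} o s≢0 = w * - o , root , only-root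
    where
    open ≡-Reasoning
    w = proj₁ (inverse s s≢0)
    sw≡1 = proj₂ (inverse s s≢0)
    root : s * (w * - o) + o ≡ 0#
    root = begin
      s * (w * - o) + o  ≡⟨ cong (_+ o) (sym (*-assoc s w (- o))) ⟩
      (s * w) * - o + o  ≡⟨ cong (λ z → z * - o + o) sw≡1 ⟩
      1# * - o + o       ≡⟨ cong (_+ o) (*-identityˡ (- o)) ⟩
      - o + o            ≡⟨ -‿inverseˡ o ⟩
      0#                 ∎
    only-root : ∀ a → s * a + o ≡ 0# → a ≡ w * - o
    only-root a sa+o≡0 = *-cancelˡ s≢0 (begin
      s * a              ≡⟨ x-y≡0⇒x≡y (trans (cong (s * a +_) (⁻¹-involutive o)) sa+o≡0) ⟩
      - o                ≡⟨ sym (*-identityˡ (- o)) ⟩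
      1# * - o           ≡⟨ cong (_* - o) (sym sw≡1) ⟩
      (s * w) * - o      ≡⟨ *-assoc s w (- o) ⟩
      s * (w * - o)      ∎)

  -- Rank and tangency under M ↦ A M Aᵀ

  sum3-cong : ∀ {f g : Fin 3 → F} → (∀ k → f k ≡ g k) → sum3 K f ≡ sum3 K g
  sum3-cong f≗g = cong₂ _+_ (cong₂ _+_ (f≗g 0F) (f≗g 1F)) (f≗g 2F)

  sum3-zero : ∀ {f : Fin 3 → F} → (∀ k → f k ≡ 0#) → sum3 K f ≡ 0#
  sum3-zero f≗0 = trans (sum3-cong f≗0) (trans (+-identityʳ _) (+-identityʳ _))

  matVec-cong : ∀ M {v w : Vec3 K} → (∀ k → v k ≡ w k) → ∀ i → matVec K M v i ≡ matVec K M w i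
  matVec-cong M v≗w i = sum3-cong λ k → cong (M i k *_) (v≗w k)

  act-cong : ∀ Q {M N : Mat K} → (∀ i j → M i j ≡ N i j) → ∀ i j → act K Q M i j ≡ act K Q N i j
  act-cong Q M≗N i j = sum3-cong λ c → cong (_* Q j c) (sum3-cong λ k → cong (Q i k *_) (M≗N k c))

  det-cong : ∀ {M N : Mat K} → (∀ i j → M i j ≡ N i j) → det K M ≡ det K N
  det-cong {M} {N} M≗N =
    cong₂ _+_ (cong₂ _+_ (cong₂ _*_ (M≗N 0F 0F) (minor-cong 1F 2F 1F 2F))
                         (cong₂ _*_ (M≗N 0F 1F) (cong -_ (minor-cong 1F 2F 0F 2F))))
              (cong₂ _*_ (M≗N 0F 2F) (minor-cong 1F 2F 0F 1F))
    where
    minor-cong : ∀ i j k l → minor M i j k l ≡ minor N i j k l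
    minor-cong i j k l = cong₂ _+_ (cong₂ _*_ (M≗N i k) (M≗N j l)) (cong -_ (cong₂ _*_ (M≗N i l) (M≗N j k)))

  det-act : ∀ Q M → det K (act K Q M) ≡ (det K Q * det K M) * det K Q
  det-act Q M = trans (det-matMul (matMul K Q M) (transpose K Q)) (cong₂ _*_ (det-matMul Q M) (det-transpose Q))

  invertible⇒det≢0 : ∀ A → Invertible K A → det K A ≢ 0#
  invertible⇒det≢0 A (B , AB≡I) detA≡0 = 0≢1 (begin
    0#                        ≡⟨ sym (zeroˡ (det K B)) ⟩
    0# * det K B              ≡⟨ cong (_* det K B) (sym detA≡0) ⟩
    det K A * det K B         ≡⟨ sym (det-matMul A B) ⟩
    det K (matMul K A B)      ≡⟨ det-cong AB≡I ⟩
    det K (identity K)        ≡⟨ det-identity ⟩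
    1#                        ∎)
    where open ≡-Reasoning

  allMinors-cong : ∀ M N →  (∀ i j → M i j ≡ N i j) → AllMinors2Vanish K M → AllMinors2Vanish K N
  allMinors-cong M N M≗N h i j k l =
    trans (sym (cong₂ _*_ (M≗N i k) (M≗N j l))) (trans (h i j k l) (cong₂ _*_ (M≗N i l) (M≗N j k)))

  isZero⇒allMinors : ∀ M → IsZeroMat K M → AllMinors2Vanish K M
  isZero⇒allMinors M z i j k l = trans (cong₂ _*_ (z i k) (z j l)) (sym (cong₂ _*_ (z i l) (z j k)))

  allMinors⇒det≡0 : ∀ M → AllMinors2Vanish K M → det K M ≡ 0#
  allMinors⇒det≡0 M h =
    trans (cong₂ _+_ (cong₂ _+_ (cong (M 0F 0F *_) (vanishes 1F 2F 1F 2F))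
                                (cong (λ m → M 0F 1F * - m) (vanishes 1F 2F 0F 2F)))
                     (cong (M 0F 2F *_) (vanishes 1F 2F 0F 1F)))
          (prove (M 0F 0F ∷ M 0F 1F ∷ M 0F 2F ∷ []) (x :* o :+ y :* :- o :+ z :* o) o refl)
    where
    vanishes : ∀ i j k l → minor M i j k l ≡ 0#
    vanishes i j k l = x≡y⇒x-y≡0 (h i j k l)
    x y z o : Polynomial 3
    x = var 0F
    y = var 1F
    z = var 2F
    o = con (ℤ.+ 0)

  allMinors-act : ∀ Q M → AllMinors2Vanish K M → AllMinors2Vanish K (act K Q M)
  allMinors-act Q M h i j k l = x-y≡0⇒x≡y (trans (minor-act Q M i j k l)
    (sum3-zero λ a → sum3-zero λ b → sum3-zero λ c → sum3-zero λ e →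
      trans (cong ((Q i a * Q j b) * (Q k c * Q l e) *_) (x≡y⇒x-y≡0 (h a b c e))) (zeroʳ _)))

  allMinors-scale⁻¹ : ∀ c M → c ≢ 0# → AllMinors2Vanish K (λ i j → c * M i j) → AllMinors2Vanish K M
  allMinors-scale⁻¹ c M c≢0 h i j k l = *-cancelˡ (x*y≢0 c≢0 c≢0) (begin
    (c * c) * (M i k * M j l)    ≡⟨ interchange c (M i k) c (M j l) ⟨
    (c * M i k) * (c * M j l)    ≡⟨ h i j k l ⟩
    (c * M i l) * (c * M j k)    ≡⟨ interchange c (M i l) c (M j k) ⟩
    (c * c) * (M i l * M j k)    ∎)
    where open ≡-Reasoning

  isZero-act : ∀ Q M → IsZeroMat K M → IsZeroMat K (act K Q M)
  isZero-act Q M z i j = sum3-zero λ c →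
    trans (cong (_* Q j c) (sum3-zero λ k → trans (cong (Q i k *_) (z k c)) (zeroʳ (Q i k)))) (zeroˡ (Q j c))

  -- act (adjugate A) undoes act A up to the scalar (det A)², nonzero for invertible A.
  module _ (A : Mat K) (invA : Invertible K A) where

    private
      d : F
      d = det K A
      d≢0 : d ≢ 0#
      d≢0 = invertible⇒det≢0 A invA
      e : F
      e = proj₁ (inverse d d≢0)
      e*d≡1 : e * d ≡ 1#
      e*d≡1 = trans (*-comm e d) (proj₂ (inverse d d≢0))

    isZero-act⁻¹ : ∀ M → IsZeroMat K (act K A M) → IsZeroMat K M
    isZero-act⁻¹ M z i j = x*y≡0⇒y≡0 (x*y≢0 d≢0 d≢0)
      (trans (sym (act-adjugate A M i j)) (isZero-act (adjugate A) (act K A M) z i j))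

    allMinors-act⁻¹ : ∀ M → AllMinors2Vanish K (act K A M) → AllMinors2Vanish K M
    allMinors-act⁻¹ M h = allMinors-scale⁻¹ (d * d) M (x*y≢0 d≢0 d≢0)
      (allMinors-cong _ (λ i j → (d * d) * M i j) (act-adjugate A M) (allMinors-act (adjugate A) (act K A M) h))

    rank1-act : ∀ M → Rank1 K M → Rank1 K (act K A M)
    rank1-act M (M≢0 , h) = (λ z → M≢0 (isZero-act⁻¹ M z)) , allMinors-act A M h

    rank2-act : ∀ M → Rank2 K M → Rank2 K (act K A M)
    rank2-act M (M≢0 , ¬h , detM≡0) =
      (λ z → M≢0 (isZero-act⁻¹ M z)) , (λ h → ¬h (allMinors-act⁻¹ M h)) ,
      trans (det-act A M) (trans (cong (λ m → (d * m) * d) detM≡0) (trans (cong (_* d) (zeroʳ d)) (zeroˡ d)))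

    rank3-act : ∀ M → Rank3 K M → Rank3 K (act K A M)
    rank3-act M detM≢0 detN≡0 = x*y≢0 (x*y≢0 d≢0 detM≢0) d≢0 (trans (sym (det-act A M)) detN≡0)

    inColSpace-act : ∀ M x → InColSpace K M x → InColSpace K (act K A M) (matVec K A x)
    inColSpace-act M x (v , Mv≡x) = w , λ i → begin
      matVec K (act K A M) w i                                    ≡⟨ matVec-act A M w i ⟩
      matVec K A (matVec K M (matVec K (transpose K A) w)) i      ≡⟨ matVec-cong A (matVec-cong M Aᵀw≡v) i ⟩
      matVec K A (matVec K M v) i                                 ≡⟨ matVec-cong A Mv≡x i ⟩
      matVec K A x i                                              ∎
      where
      open ≡-Reasoning
      w : Vec3 K
      w k = e * matVec K (transpose K (adjugate A)) v k
      Aᵀw≡v : ∀ k → matVec K (transpose K A) w k ≡ v k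
      Aᵀw≡v k = trans (transpose-adjugate-matVec A e v k) (trans (cong (_* v k) e*d≡1) (*-identityˡ (v k)))

    linIndep-act : ∀ x y → LinIndep K x y → LinIndep K (matVec K A x) (matVec K A y)
    linIndep-act x y indep p r p·Ax+r·Ay≡0 = indep p r z≡0
      where
      z : Vec3 K
      z k = p * x k + r * y k
      Az≡0 : ∀ i → matVec K A z i ≡ 0#
      Az≡0 i = trans (matVec-linear A p r x y i) (p·Ax+r·Ay≡0 i)
      z≡0 : ∀ i → z i ≡ 0#
      z≡0 i = x*y≡0⇒y≡0 d≢0 (begin
        d * z i                                  ≡⟨ adjugate-matVec A z i ⟨
        matVec K (adjugate A) (matVec K A z) i   ≡⟨ matVec-cong (adjugate A) Az≡0 i ⟩
        matVec K (adjugate A) (λ _ → 0#) i       ≡⟨ sum3-zero (λ k → zeroʳ (adjugate A i k)) ⟩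
        0#                                       ∎)
        where open ≡-Reasoning

    onTangent-act : ∀ M → OnTangentOfItsConic K M → OnTangentOfItsConic K (act K A M)
    onTangent-act M (x , y , λ′ , μ , x∈M , y∈M , indep , M≡form) =
      matVec K A x , matVec K A y , λ′ , μ , inColSpace-act M x x∈M , inColSpace-act M y y∈M , linIndep-act x y indep ,
      λ i j → trans (act-cong A M≡form i j) (act-TangentForm A λ′ μ x y i j)

    exterior-act : ∀ M → Exterior K M → Exterior K (act K A M)
    exterior-act M (rank2 , tangent) = rank2-act M rank2 , onTangent-act M tangent

  -- The plane of Σ₁₁

  Rank1Params Rank2Params Rank3Params : Triple K → Set
  Rank1Params (α , β , γ) = β ≡ 0# × γ ≡ 0# × α ≢ 0#
  Rank2Params (α , β , γ) = ¬ (β ≡ 0# × γ ≡ 0#) × det K (sigma11 K (α , β , γ)) ≡ 0#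
  Rank3Params t = det K (sigma11 K t) ≢ 0#

  sigma11-diagonal-det : ∀ α β → det K (sigma11 K (α , β , β)) ≡ detOffset β β
  sigma11-diagonal-det α β = begin
    det K (sigma11 K (α , β , β))       ≡⟨ sigma11-det α β β ⟩
    detSlope β β * α + detOffset β β    ≡⟨ cong (λ s → s * α + detOffset β β) (detSlope-diagonal β) ⟩
    0# * α + detOffset β β              ≡⟨ cong (_+ detOffset β β) (zeroˡ α) ⟩
    0# + detOffset β β                  ≡⟨ +-identityˡ (detOffset β β) ⟩
    detOffset β β                       ∎
    where open ≡-Reasoning

  detOffset-diagonal≢0 : ∀ {β} → β ≢ 0# → detOffset β β ≢ 0#
  detOffset-diagonal≢0 β≢0 offset≡0 = x*y≢0 (x*y≢0 β≢0 β≢0) β≢0 (-x≡0⇒x≡0 offset≡0)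

  detOffset-origin : detOffset 0# 0# ≡ 0#
  detOffset-origin = trans (cong -_ (zeroʳ (0# * 0#))) ε⁻¹≈ε

  detSlope≢0 : ∀ {β γ} → γ ≢ β → detSlope β γ ≢ 0#
  detSlope≢0 γ≢β slope≡0 = γ≢β (sym (x-y≡0⇒x≡y (x*x≡0⇒x≡0 (-x≡0⇒x≡0 slope≡0))))

  tangency≢0 : ∀ {β γ} → γ ≢ β → tangency β γ ≢ 0#
  tangency≢0 γ≢β = x*y≢0 char≢2 (x*y≢0 β-γ≢0 β-γ≢0)
    where β-γ≢0 = λ β-γ≡0 → γ≢β (sym (x-y≡0⇒x≡y β-γ≡0))

  rank2Params⇒γ≢β : ∀ α β γ → Rank2Params (α , β , γ) → γ ≢ β
  rank2Params⇒γ≢β α β γ (βγ≢0 , det≡0) refl =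
    βγ≢0 (β≡0 , β≡0)
    where
    β≡0 : β ≡ 0#
    β≡0 with β ≟ 0#
    ... | yes β≡0 = β≡0
    ... | no β≢0 = ⊥-elim (detOffset-diagonal≢0 β≢0 (trans (sym (sigma11-diagonal-det α β)) det≡0))

  sigma11-rank1 : ∀ t → Rank1Params t → Rank1 K (sigma11 K t)
  sigma11-rank1 (α , _ , _) (refl , refl , α≢0) =
    (λ z → α≢0 (z 1F 1F)) ,
    allMinors-cong (λ i j → α * (axis i * axis j)) (sigma11 K (α , 0# , 0#)) (λ i j → sym (sigma11-axis α i j))
      (λ i j k l → scaledOuter-minor α (axis i) (axis j) (axis k) (axis l))

  sigma11-not-allMinors : ∀ α β γ → ¬ (β ≡ 0# × γ ≡ 0#) → ¬ AllMinors2Vanish K (sigma11 K (α , β , γ))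
  sigma11-not-allMinors α β γ βγ≢0 h = βγ≢0
    (x*x≡0⇒x≡0 (trans (sym (h 0F 1F 0F 1F)) (zeroˡ α)) , x*x≡0⇒x≡0 (trans (sym (h 0F 2F 0F 2F)) (zeroˡ (α + γ))))

  sigma11-rank2 : ∀ t → Rank2Params t → Rank2 K (sigma11 K t)
  sigma11-rank2 t@(α , β , γ) (βγ≢0 , det≡0) =
    (λ z → ¬minors (isZero⇒allMinors (sigma11 K t) z)) , ¬minors , det≡0
    where ¬minors = sigma11-not-allMinors α β γ βγ≢0

  -- By sigma11-tangency, det = 0 makes the plane matrix e (x yᵀ + y xᵀ) with e = tangency⁻¹.
  sigma11-onTangent : ∀ t → Rank2Params t → OnTangentOfItsConic K (sigma11 K t)
  sigma11-onTangent t@(α , β , γ) params@(βγ≢0 , det≡0) =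
    columnˣ β γ , columnʸ β γ , 0# , e ,
    (preimageˣ , sigma11-columnˣ α β γ) , (preimageʸ β γ , sigma11-columnʸ α β γ) , independent , onTangent
    where
    open ≡-Reasoning
    T = tangency β γ
    T≢0 : T ≢ 0#
    T≢0 = tangency≢0 (rank2Params⇒γ≢β α β γ params)
    e = proj₁ (inverse T T≢0)
    e*T≡1 : e * T ≡ 1#
    e*T≡1 = trans (*-comm e T) (proj₂ (inverse T T≢0))

    onTangent : ∀ i j → sigma11 K t i j ≡ 0# * (columnˣ β γ i * columnˣ β γ j) +
                        e * (columnˣ β γ i * columnʸ β γ j + columnʸ β γ i * columnˣ β γ j)
    onTangent i j = sym (begin
      0# * (columnˣ β γ i * columnˣ β γ j) + e * xyᵀ+yxᵀ
        ≡⟨ cong (_+ e * xyᵀ+yxᵀ) (zeroˡ (columnˣ β γ i * columnˣ β γ j)) ⟩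
      0# + e * xyᵀ+yxᵀ
        ≡⟨ +-identityˡ (e * xyᵀ+yxᵀ) ⟩
      e * xyᵀ+yxᵀ
        ≡⟨ cong (e *_) (sigma11-tangency α β γ i j) ⟩
      e * (T * σ + twice (detSlope β γ * α + detOffset β γ) * (axis i * axis j))
        ≡⟨ cong (λ D → e * (T * σ + twice D * (axis i * axis j))) (trans (sym (sigma11-det α β γ)) det≡0) ⟩
      e * (T * σ + twice 0# * (axis i * axis j))
        ≡⟨ cong (λ z → e * (T * σ + z * (axis i * axis j))) (zeroʳ (1# + 1#)) ⟩
      e * (T * σ + 0# * (axis i * axis j))
        ≡⟨ cong (λ z → e * (T * σ + z)) (zeroˡ (axis i * axis j)) ⟩
      e * (T * σ + 0#)
        ≡⟨ cong (e *_) (+-identityʳ (T * σ)) ⟩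
      e * (T * σ)
        ≡⟨ sym (*-assoc e T σ) ⟩
      (e * T) * σ
        ≡⟨ cong (_* σ) e*T≡1 ⟩
      1# * σ
        ≡⟨ *-identityˡ σ ⟩
      σ ∎)
      where
      σ = sigma11 K t i j
      xyᵀ+yxᵀ = columnˣ β γ i * columnʸ β γ j + columnʸ β γ i * columnˣ β γ j

    independent : LinIndep K (columnˣ β γ) (columnʸ β γ)
    independent p r combination≡0 = p≡0 , r≡0
      where
      r≡0 : r ≡ 0#
      r≡0 = x*y≡0⇒y≡0 T≢0 (begin
        T * r              ≡⟨ *-comm T r ⟩
        r * T              ≡⟨ sym (+-identityˡ (r * T)) ⟩
        0# + r * T         ≡⟨ cong (_+ r * T) (sym (zeroʳ p)) ⟩
        p * 0# + r * T     ≡⟨ combination≡0 0F ⟩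
        0#                 ∎)
      p·x≡0 : ∀ i → p * columnˣ β γ i ≡ 0#
      p·x≡0 i = begin
        p * columnˣ β γ i                          ≡⟨ sym (+-identityʳ _) ⟩
        p * columnˣ β γ i + 0#                     ≡⟨ cong (p * columnˣ β γ i +_) (sym (zeroˡ (columnʸ β γ i))) ⟩
        p * columnˣ β γ i + 0# * columnʸ β γ i     ≡⟨ cong (λ z → p * columnˣ β γ i + z * columnʸ β γ i) (sym r≡0) ⟩
        p * columnˣ β γ i + r * columnʸ β γ i      ≡⟨ combination≡0 i ⟩
        0#                                         ∎
      p≡0 : p ≡ 0#
      p≡0 with β ≟ 0# | γ ≟ 0#
      ... | no β≢0 | _ = x*y≡0⇒y≡0 β≢0 (trans (*-comm β p) (p·x≡0 1F))
      ... | yes _ | no γ≢0 = x*y≡0⇒y≡0 γ≢0 (trans (*-comm γ p) (p·x≡0 2F))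
      ... | yes β≡0 | yes γ≡0 = ⊥-elim (βγ≢0 (β≡0 , γ≡0))

  sigma11-exterior : ∀ t → Rank2Params t → Exterior K (sigma11 K t)
  sigma11-exterior t params = sigma11-rank2 t params , sigma11-onTangent t params

  params-trichotomy : ∀ t → NonZeroTriple K t → Rank1Params t ⊎ Rank2Params t ⊎ Rank3Params t
  params-trichotomy (α , β , γ) t≢0 with β ≟ 0# | γ ≟ 0# | det K (sigma11 K (α , β , γ)) ≟ 0#
  ... | yes β≡0 | yes γ≡0 | _ = inj₁ (β≡0 , γ≡0 , λ α≡0 → t≢0 (α≡0 , β≡0 , γ≡0))
  ... | no β≢0 | _ | yes det≡0 = inj₂ (inj₁ ((λ βγ≡0 → β≢0 (proj₁ βγ≡0)) , det≡0))
  ... | yes _ | no γ≢0 | yes det≡0 = inj₂ (inj₁ ((λ βγ≡0 → γ≢0 (proj₂ βγ≡0)) , det≡0))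
  ... | no _ | _ | no det≢0 = inj₂ (inj₂ det≢0)
  ... | yes _ | no _ | no det≢0 = inj₂ (inj₂ det≢0)

  -- Counting parameter triples

  ∑ : (F → ℕ) → ℕ
  ∑ g = sum (map g elements)

  ∑-const : ∀ (g : F → ℕ) {k} → (∀ x → g x ≡ k) → ∑ g ≡ q ℕ.* k
  ∑-const g g≡k = sum-map-const g elements (λ {x} _ → g≡k x)

  ∑-except : ∀ (g : F → ℕ) {k} c → (∀ x → x ≢ c → g x ≡ k) → ∑ g ≡ g c ℕ.+ (q ℕ.∸ 1) ℕ.* k
  ∑-except g c = sum-map-except g unique (complete c)

  triples : List (Triple K)
  triples = cartesianProductWith (λ β γα → proj₂ γα , β , proj₁ γα) elements (cartesianProduct elements elements)

  count : {P : Triple K → Set} → Decidable P → ℕ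
  count P? = length (filter P? triples)

  count≡∑∑∑ : ∀ {P : Triple K → Set} (P? : Decidable P) →
    count P? ≡ ∑ λ β → ∑ λ γ → ∑ λ α → indicator (P? (α , β , γ))
  count≡∑∑∑ P? = begin
    length (filter P? triples)
      ≡⟨ length-filter≡sum-indicator P? triples ⟩
    sum (map (λ t → indicator (P? t)) triples)
      ≡⟨ sum-map-cartesianProductWith _ (λ t → indicator (P? t)) elements _ ⟩
    ∑ (λ β → sum (map (λ γα → indicator (P? (proj₂ γα , β , proj₁ γα))) (cartesianProduct elements elements)))
      ≡⟨ cong sum (map-cong (λ β → sum-map-cartesianProductWith _,_ _ elements elements) elements) ⟩
    ∑ (λ β → ∑ λ γ → ∑ λ α → indicator (P? (α , β , γ)))
      ∎
    where open ≡-Reasoning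

  hasCount : ∀ {P D : Triple K → Set} (D? : Decidable D) → (∀ t → P t ⇔ D t) → HasCount P (count D?)
  hasCount {P} {D} D? P⇔D = filter D? triples , filter⁺ D? triples-unique , P∈ , refl
    where
    triples-unique : Unique triples
    triples-unique = cartesianProductWith⁺ _ (λ eq → cong (λ t → proj₁ (proj₂ t)) eq , cong (λ t → proj₂ (proj₂ t) , proj₁ t) eq)
      unique (cartesianProduct⁺ unique unique)
    ∈-triples : ∀ t → t ∈ triples
    ∈-triples (α , β , γ) = ∈-cartesianProductWith⁺ _ (complete β) (∈-cartesianProduct⁺ (complete γ) (complete α))
    P∈ : ∀ t → (t ∈ filter D? triples) ⇔ P t
    P∈ t = mk⇔ (λ t∈ → Equivalence.from (P⇔D t) (proj₂ (∈-filter⁻ D? {xs = triples} t∈)))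
               (λ Pt → ∈-filter⁺ D? (∈-triples t) (Equivalence.to (P⇔D t) Pt))

  ∑-zero : ∀ (g : F → ℕ) → (∀ x → g x ≡ 0) → ∑ g ≡ 0
  ∑-zero g g≡0 = trans (∑-const g g≡0) (ℕ.*-zeroʳ q)

  ∑-single : ∀ (g : F → ℕ) c → (∀ x → x ≢ c → g x ≡ 0) → ∑ g ≡ g c
  ∑-single g c g≡0 = trans (∑-except g c g≡0) (trans (cong (g c ℕ.+_) (ℕ.*-zeroʳ (q ℕ.∸ 1))) (ℕ.+-identityʳ (g c)))

  rank1Params? : Decidable Rank1Params
  rank1Params? (α , β , γ) = (β ≟ 0#) ×-dec (γ ≟ 0#) ×-dec ¬? (α ≟ 0#)

  rank2Params? : Decidable Rank2Params
  rank2Params? (α , β , γ) = ¬? ((β ≟ 0#) ×-dec (γ ≟ 0#)) ×-dec (det K (sigma11 K (α , β , γ)) ≟ 0#)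

  rank3Params? : Decidable Rank3Params
  rank3Params? t = ¬? (det K (sigma11 K t) ≟ 0#)

  det-root : ∀ {β γ} → γ ≢ β → ∃[ r ] (det K (sigma11 K (r , β , γ)) ≡ 0# × ∀ α → det K (sigma11 K (α , β , γ)) ≡ 0# → α ≡ r)
  det-root {β} {γ} γ≢β with linear-root (detOffset β γ) (detSlope≢0 γ≢β)
  ... | r , root , only-root = r , trans (sigma11-det r β γ) root , λ α det≡0 → only-root α (trans (sym (sigma11-det α β γ)) det≡0)

  count-rank1Params : count rank1Params? ≡ 1 ℕ.* (q ℕ.∸ 1)
  count-rank1Params = begin
    count rank1Params?                 ≡⟨ count≡∑∑∑ rank1Params? ⟩
    ∑ (λ β → ∑ (fibre β))              ≡⟨ ∑-single (λ β → ∑ (fibre β)) 0# (λ β β≢0 → ∑-zero (fibre β) λ γ → off (β≢0 ∘ proj₁)) ⟩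
    ∑ (fibre 0# )                      ≡⟨ ∑-single (fibre 0#) 0# (λ γ γ≢0 → off (γ≢0 ∘ proj₂)) ⟩
    fibre 0# 0#                        ≡⟨ ∑-except (λ α → ι (α , 0# , 0#)) 0# (λ α α≢0 → indicator-yes (rank1Params? (α , 0# , 0#)) (refl , refl , α≢0)) ⟩
    ι (0# , 0# , 0#) ℕ.+ (q ℕ.∸ 1) ℕ.* 1
      ≡⟨ cong₂ ℕ._+_ (indicator-no (rank1Params? (0# , 0# , 0#)) λ { (_ , _ , 0≢0) → 0≢0 refl }) (ℕ.*-identityʳ (q ℕ.∸ 1)) ⟩
    q ℕ.∸ 1                            ≡⟨ ℕ.*-identityˡ (q ℕ.∸ 1) ⟨
    1 ℕ.* (q ℕ.∸ 1)                    ∎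
    where
    open ≡-Reasoning
    ι : Triple K → ℕ
    ι t = indicator (rank1Params? t)
    fibre : F → F → ℕ
    fibre β γ = ∑ λ α → ι (α , β , γ)
    off : ∀ {β γ} → ¬ (β ≡ 0# × γ ≡ 0#) → fibre β γ ≡ 0
    off {β} {γ} βγ≢0 = ∑-zero (λ α → ι (α , β , γ)) λ α →
      indicator-no (rank1Params? (α , β , γ)) λ { (β≡0 , γ≡0 , _) → βγ≢0 (β≡0 , γ≡0) }

  count-rank2Params : count rank2Params? ≡ q ℕ.* (q ℕ.∸ 1)
  count-rank2Params = trans (count≡∑∑∑ rank2Params?) (∑-const (λ β → ∑ (fibre β)) row)
    where
    open ≡-Reasoning
    ι : Triple K → ℕ
    ι t = indicator (rank2Params? t)
    fibre : F → F → ℕ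
    fibre β γ = ∑ λ α → ι (α , β , γ)
    off : ∀ {β γ} → γ ≢ β → fibre β γ ≡ 1
    off {β} {γ} γ≢β = begin
      fibre β γ      ≡⟨ ∑-single (λ α → ι (α , β , γ)) r (λ α α≢r → indicator-no (rank2Params? (α , β , γ))
                          λ { (_ , det≡0′) → α≢r (only-root α det≡0′) }) ⟩
      ι (r , β , γ)  ≡⟨ indicator-yes (rank2Params? (r , β , γ)) ((λ { (β≡0 , γ≡0) → γ≢β (trans γ≡0 (sym β≡0)) }) , det≡0) ⟩
      1              ∎
      where
      r = proj₁ (det-root γ≢β)
      det≡0 = proj₁ (proj₂ (det-root γ≢β))
      only-root = proj₂ (proj₂ (det-root γ≢β))
    diagonal : ∀ β → fibre β β ≡ 0
    diagonal β = ∑-zero (λ α → ι (α , β , β)) λ α →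
      indicator-no (rank2Params? (α , β , β)) λ params → rank2Params⇒γ≢β α β β params refl
    row : ∀ β → ∑ (fibre β) ≡ q ℕ.∸ 1
    row β = begin
      ∑ (fibre β)                        ≡⟨ ∑-except (fibre β) β (λ γ γ≢β → off γ≢β) ⟩
      fibre β β ℕ.+ (q ℕ.∸ 1) ℕ.* 1      ≡⟨ cong₂ ℕ._+_ (diagonal β) (ℕ.*-identityʳ (q ℕ.∸ 1)) ⟩
      q ℕ.∸ 1                            ∎

  count-rank3Params : count rank3Params? ≡ (q ℕ.* q) ℕ.* (q ℕ.∸ 1)
  count-rank3Params = begin
    count rank3Params?                                ≡⟨ count≡∑∑∑ rank3Params? ⟩
    ∑ (λ β → ∑ (fibre β))                             ≡⟨ ∑-except (λ β → ∑ (fibre β)) 0# (λ β β≢0 → trans (row β) (cong (ℕ._+ p ℕ.* p) (diagonal β≢0))) ⟩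
    ∑ (fibre 0#) ℕ.+ p ℕ.* (q ℕ.+ p ℕ.* p)            ≡⟨ cong (ℕ._+ p ℕ.* (q ℕ.+ p ℕ.* p)) (trans (row 0#) (cong (ℕ._+ p ℕ.* p) origin)) ⟩
    (0 ℕ.+ p ℕ.* p) ℕ.+ p ℕ.* (q ℕ.+ p ℕ.* p)        ≡⟨ cong (λ n → (0 ℕ.+ p ℕ.* p) ℕ.+ p ℕ.* (n ℕ.+ p ℕ.* p)) q≡1+p ⟩
    (0 ℕ.+ p ℕ.* p) ℕ.+ p ℕ.* (ℕ.suc p ℕ.+ p ℕ.* p)  ≡⟨ total p ⟩
    (ℕ.suc p ℕ.* ℕ.suc p) ℕ.* p                       ≡⟨ cong (λ n → (n ℕ.* n) ℕ.* p) q≡1+p ⟨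
    (q ℕ.* q) ℕ.* p                                   ∎
    where
    open ≡-Reasoning
    p : ℕ
    p = q ℕ.∸ 1
    q≡1+p : q ≡ ℕ.suc p
    q≡1+p = ∈⇒length≡suc[length∸1] (complete 0#)
    total : ∀ p → (0 ℕ.+ p ℕ.* p) ℕ.+ p ℕ.* (ℕ.suc p ℕ.+ p ℕ.* p) ≡ (ℕ.suc p ℕ.* ℕ.suc p) ℕ.* p
    total = solve-∀
    ι : Triple K → ℕ
    ι t = indicator (rank3Params? t)
    fibre : F → F → ℕ
    fibre β γ = ∑ λ α → ι (α , β , γ)
    off : ∀ {β γ} → γ ≢ β → fibre β γ ≡ p
    off {β} {γ} γ≢β = begin
      fibre β γ                  ≡⟨ ∑-except (λ α → ι (α , β , γ)) r (λ α α≢r → indicator-yes (rank3Params? (α , β , γ))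
                                      λ det≡0′ → α≢r (only-root α det≡0′)) ⟩
      ι (r , β , γ) ℕ.+ p ℕ.* 1  ≡⟨ cong₂ ℕ._+_ (indicator-no (rank3Params? (r , β , γ)) λ det≢0 → det≢0 det≡0) (ℕ.*-identityʳ p) ⟩
      p                          ∎
      where
      r = proj₁ (det-root γ≢β)
      det≡0 = proj₁ (proj₂ (det-root γ≢β))
      only-root = proj₂ (proj₂ (det-root γ≢β))
    diagonal : ∀ {β} → β ≢ 0# → fibre β β ≡ q
    diagonal {β} β≢0 = trans
      (∑-const (λ α → ι (α , β , β)) λ α → indicator-yes (rank3Params? (α , β , β)) λ det≡0 →
        detOffset-diagonal≢0 β≢0 (trans (sym (sigma11-diagonal-det α β)) det≡0))
      (ℕ.*-identityʳ q)
    origin : fibre 0# 0# ≡ 0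
    origin = ∑-zero (λ α → ι (α , 0# , 0#)) λ α → indicator-no (rank3Params? (α , 0# , 0#)) λ det≢0 →
      det≢0 (trans (sigma11-diagonal-det α 0#) detOffset-origin)
    row : ∀ β → ∑ (fibre β) ≡ fibre β β ℕ.+ p ℕ.* p
    row β = ∑-except (fibre β) β (λ γ γ≢β → off γ≢β)

  rank1⇒¬rank2 : ∀ M → Rank1 K M → ¬ Rank2 K M
  rank1⇒¬rank2 M (_ , minors) (_ , ¬minors , _) = ¬minors minors

  rank1⇒¬rank3 : ∀ M → Rank1 K M → ¬ Rank3 K M
  rank1⇒¬rank3 M (_ , minors) det≢0 = det≢0 (allMinors⇒det≡0 M minors)

  rank2⇒¬rank3 : ∀ M → Rank2 K M → ¬ Rank3 K M
  rank2⇒¬rank3 M (_ , _ , det≡0) det≢0 = det≢0 det≡0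

  module _ (A : Mat K) (invA : Invertible K A) where

    private
      N : Triple K → Mat K
      N t = act K A (sigma11 K t)

      rank1-of : ∀ t → Rank1Params t → Rank1 K (N t)
      rank1-of t p = rank1-act A invA (sigma11 K t) (sigma11-rank1 t p)

      exterior-of : ∀ t → Rank2Params t → Exterior K (N t)
      exterior-of t p = exterior-act A invA (sigma11 K t) (sigma11-exterior t p)

      rank3-of : ∀ t → Rank3Params t → Rank3 K (N t)
      rank3-of t p = rank3-act A invA (sigma11 K t) p

      classify : ∀ {X : Set} t → NonZeroTriple K t →
        (Rank1Params t → X) → (Rank2Params t → X) → (Rank3Params t → X) → X
      classify t t≢0 f₁ f₂ f₃ = [ f₁ , [ f₂ , f₃ ]′ ]′ (params-trichotomy t t≢0)

    rank1⇔rank1Params : ∀ t → (NonZeroTriple K t × Rank1 K (N t)) ⇔ Rank1Params t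
    rank1⇔rank1Params t = mk⇔
      (λ { (t≢0 , rank1) → classify t t≢0 (λ p → p)
             (λ p → ⊥-elim (rank1⇒¬rank2 (N t) rank1 (proj₁ (exterior-of t p))))
             (λ p → ⊥-elim (rank1⇒¬rank3 (N t) rank1 (rank3-of t p))) })
      (λ p → (λ { (α≡0 , _) → proj₂ (proj₂ p) α≡0 }) , rank1-of t p)

    exterior⇔rank2Params : ∀ t → (NonZeroTriple K t × Exterior K (N t)) ⇔ Rank2Params t
    exterior⇔rank2Params t = mk⇔
      (λ { (t≢0 , (rank2 , _)) → classify t t≢0
             (λ p → ⊥-elim (rank1⇒¬rank2 (N t) (rank1-of t p) rank2))
             (λ p → p)
             (λ p → ⊥-elim (rank2⇒¬rank3 (N t) rank2 (rank3-of t p))) })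
      (λ p → (λ { (_ , β≡0 , γ≡0) → proj₁ p (β≡0 , γ≡0) }) , exterior-of t p)

    no-interior : ∀ t → ¬ (NonZeroTriple K t × Interior K (N t))
    no-interior t (t≢0 , rank2 , ¬tangent) = classify t t≢0
      (λ p → rank1⇒¬rank2 (N t) (rank1-of t p) rank2)
      (λ p → ¬tangent (proj₂ (exterior-of t p)))
      (λ p → rank2⇒¬rank3 (N t) rank2 (rank3-of t p))

    rank3⇔rank3Params : ∀ t → (NonZeroTriple K t × Rank3 K (N t)) ⇔ Rank3Params t
    rank3⇔rank3Params t = mk⇔
      (λ { (t≢0 , rank3) → classify t t≢0
             (λ p → ⊥-elim (rank1⇒¬rank3 (N t) (rank1-of t p) rank3))
             (λ p → ⊥-elim (rank2⇒¬rank3 (N t) (proj₁ (exterior-of t p)) rank3))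
             (λ p → p) })
      (λ p → (λ { (refl , refl , refl) → p (trans (sigma11-diagonal-det 0# 0#) detOffset-origin) }) , rank3-of t p)

open import Data.Nat using (_*_)

lemma7p7 : (K : FiniteOddField) → (A : Mat K) → Invertible K A →
    PointOrbitDistribution K (λ t → act K A (sigma11 K t))
    1 (FiniteOddField.q K) 0 (FiniteOddField.q K * FiniteOddField.q K)
lemma7p7 K A invA =
  subst (HasCount _) (count-rank1Params K) (hasCount K (rank1Params? K) (rank1⇔rank1Params K A invA)) ,
  subst (HasCount _) (count-rank2Params K) (hasCount K (rank2Params? K) (exterior⇔rank2Params K A invA)) ,
  ([] , [] , (λ t → mk⇔ (λ ()) (⊥-elim ∘ no-interior K A invA t)) , refl) ,
  subst (HasCount _) (count-rank3Params K) (hasCount K (rank3Params? K) (rank3⇔rank3Params K A invA))
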